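{- Let $n\geq 2$ be an integer. Then the parameter set $t$-$(v,k,\lambda)$ with $t=3$, $v=(2n-1)(4n-1)+1$, $k=4n-1$, $\lambda=1$ is admissible, but there is no block design with these parameters.
   Context: A $t$-$(v,k,\lambda)$ (block) design is a set $D$ of $k$-element subsets (blocks) of a $v$-element set $V$ such that every $t$-element subset of $V$ is contained in exactly $\lambda$ blocks (blocks are not repeated). The parameter set $t$-$(v,k,\lambda)$ is admissible if $\lambda_i=\frac{\binom{v-i}{t-i}}{\binom{k-i}{t-i}}\lambda$ is an integer for all $i\in\{0,\ldots,t\}$. -}

module Defs where

open import Data.Nat using (ℕ; _∸_; _*_; _≤_; _≡ᵇ_)
open import Data.Nat.Divisibility using (_∣_)
open import Data.Nat.Combinatorics using (_C_)
open import Data.Fin.Subset using (Subset; ∣_∣; _⊆_)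
open import Data.Fin.Subset.Properties using (_⊆?_)
open import Data.List using (List; length; filter)
open import Data.List.Relation.Unary.All using (All)
open import Data.List.Relation.Unary.Unique.Propositional using (Unique)
open import Data.Product using (_×_)
open import Relation.Binary.PropositionalEquality using (_≡_)

-- Admissibility of t-(v,k,λ): for every i ∈ {0,…,t},
-- λ_i = C(v-i,t-i)/C(k-i,t-i) · λ is an integer, i.e.
-- C(k-i,t-i) divides C(v-i,t-i) · λ.
Admissible : ℕ → ℕ → ℕ → ℕ → Set
Admissible t v k lam =
  ∀ i → i ≤ t → ((k ∸ i) C (t ∸ i)) ∣ (((v ∸ i) C (t ∸ i)) * lam)

countContaining : ∀ {v} → List (Subset v) → Subset v → ℕ
countContaining D T = length (filter (λ B → T ⊆? B) D)

-- A t-(v,k,λ) design on the point set Fin v: a finite set D of blocks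
-- (a duplicate-free list of subsets of Fin v), each of size k, such that
-- every t-subset of Fin v lies in exactly λ blocks.
IsDesign : (t v k lam : ℕ) → List (Subset v) → Set
IsDesign t v k lam D =
  Unique D ×
  All (λ B → ∣ B ∣ ≡ k) D ×
  (∀ (T : Subset v) → ∣ T ∣ ≡ t → countContaining D T ≡ lam)

module Submission where

-- Fix a block B, a point p ∈ B and a point x ∉ B.  For each of the k - 1 points
-- y ∈ B - p, the block through p, x, y has k - 2 further points, and these sets are
-- pairwise disjoint: a common point z would force the two blocks through p, x, z to
-- coincide, so that block would contain p and two points of B, hence be B, which
-- misses x.  Thus (k - 1)(k - 2) ≤ v - 2 in every 3-(v,k,1) design with k < v, and
-- this fails for k = 4n - 1, v = (2n - 1)(4n - 1) + 1.  Admissibility is a direct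
-- divisibility check.

open import Defs
open import Data.Nat using (ℕ; zero; suc; _≤_; _<_; _+_; _*_; _∸_; z≤n; s≤s)
open import Data.Nat.Properties
  using (+-suc; +-monoʳ-≤; *-distribˡ-+; m+1+n≰m; m<m+n; <⇒≱; module ≤-Reasoning)
open import Data.Nat.Divisibility using (_∣_; divides; 1∣_; ∣m⇒∣m*n; *-cancelˡ-∣)
open import Data.Nat.Combinatorics using (_C_; nC1≡n; nCk+nC[k+1]≡[n+1]C[k+1])
open import Data.Nat.Tactic.RingSolver using (solve-∀)
open import Data.Fin using (Fin; zero; suc; _≟_)
open import Data.Fin.Properties using (0≢1+n; suc-injective; ¬∀⟶∃¬)
open import Data.Fin.Subset
  using (Subset; inside; outside; _∈_; _∉_; _⊆_; ⁅_⁆; _∪_; _─_; _-_; ⊤; ∣_∣; Nonempty)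
open import Data.Fin.Subset.Properties
  using (drop-∷-⊆; p─q⊆p; x∈p∧x∉q⇒x∈p─q; x∈p∧x≢y⇒x∈p-y; x∈⁅x⁆; x∈⁅y⁆⇒x≡y; x∉⁅y⁆⇒x≢y; ∣⁅x⁆∣≡1; ⊆-refl;
         x∈p∪q⁺; x∈p∪q⁻; Empty-unique; ∣⊥∣≡0; ∈⊤; ∣⊤∣≡n; p⊆q⇒∣p∣≤∣q∣; _∈?_; _⊆?_)
open import Data.List using (List; []; _∷_; length; filter)
open import Data.List.Membership.Propositional using () renaming (_∈_ to _∈ₗ_)
open import Data.List.Membership.Propositional.Properties using (∈-filter⁺; ∈-filter⁻)
open import Data.List.Relation.Unary.All as All using ()
open import Data.List.Relation.Unary.Any as Any using ()
open import Data.Product using (_×_; ∃; _,_; proj₁; proj₂)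
open import Data.Sum using (_⊎_; inj₁; inj₂)
open import Data.Vec using ([]; _∷_; here; there)
open import Function using (_∘_)
open import Relation.Binary.PropositionalEquality
  using (_≡_; _≢_; refl; sym; trans; cong; cong₂; subst; subst₂; module ≡-Reasoning)
open import Relation.Nullary using (¬_; contradiction)
open import Relation.Nullary.Decidable using (decidable-stable)

private
  variable
    m n s : ℕ
    x y z : Fin n
    p q T : Subset n

x∈p─q⇒x∉q : x ∈ p ─ q → x ∉ q
x∈p─q⇒x∉q {p = _ ∷ _} {q = outside ∷ _} here ()
x∈p─q⇒x∉q {p = _ ∷ _} {q = _ ∷ _} (there x∈p─q) (there x∈q) = x∈p─q⇒x∉q x∈p─q x∈q

x∈p-y⇒x≢y : x ∈ p - y → x ≢ y
x∈p-y⇒x≢y x∈p-y = x∉⁅y⁆⇒x≢y (x∈p─q⇒x∉q x∈p-y)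

p⊆q⇒∣q∣≡∣p∣+∣q─p∣ : p ⊆ q → ∣ q ∣ ≡ ∣ p ∣ + ∣ q ─ p ∣
p⊆q⇒∣q∣≡∣p∣+∣q─p∣ {p = []}          {q = []}          _   = refl
p⊆q⇒∣q∣≡∣p∣+∣q─p∣ {p = inside  ∷ p} {q = inside  ∷ q} p⊆q = cong suc (p⊆q⇒∣q∣≡∣p∣+∣q─p∣ (drop-∷-⊆ p⊆q))
p⊆q⇒∣q∣≡∣p∣+∣q─p∣ {p = inside  ∷ p} {q = outside ∷ q} p⊆q = contradiction (p⊆q here) λ ()
p⊆q⇒∣q∣≡∣p∣+∣q─p∣ {p = outside ∷ p} {q = inside  ∷ q} p⊆q =
  trans (cong suc (p⊆q⇒∣q∣≡∣p∣+∣q─p∣ (drop-∷-⊆ p⊆q))) (sym (+-suc ∣ p ∣ _))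
p⊆q⇒∣q∣≡∣p∣+∣q─p∣ {p = outside ∷ p} {q = outside ∷ q} p⊆q = p⊆q⇒∣q∣≡∣p∣+∣q─p∣ (drop-∷-⊆ p⊆q)

x∈p⇒∣p∣≡1+∣p-x∣ : x ∈ p → ∣ p ∣ ≡ suc ∣ p - x ∣
x∈p⇒∣p∣≡1+∣p-x∣ {x = x} {p = p} x∈p = begin
  ∣ p ∣                   ≡⟨ p⊆q⇒∣q∣≡∣p∣+∣q─p∣ ⁅x⁆⊆p ⟩
  ∣ ⁅ x ⁆ ∣ + ∣ p - x ∣   ≡⟨ cong (_+ ∣ p - x ∣) (∣⁅x⁆∣≡1 x) ⟩
  suc ∣ p - x ∣           ∎
  where
  open ≡-Reasoning
  ⁅x⁆⊆p : ⁅ x ⁆ ⊆ p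
  ⁅x⁆⊆p y∈⁅x⁆ = subst (_∈ p) (sym (x∈⁅y⁆⇒x≡y x y∈⁅x⁆)) x∈p

∣p∣≡2+∣p-x-y∣ : x ∈ p → y ∈ p → x ≢ y → ∣ p ∣ ≡ 2 + ∣ p - x - y ∣
∣p∣≡2+∣p-x-y∣ x∈p y∈p x≢y =
  trans (x∈p⇒∣p∣≡1+∣p-x∣ x∈p) (cong suc (x∈p⇒∣p∣≡1+∣p-x∣ (x∈p∧x≢y⇒x∈p-y y∈p (x≢y ∘ sym))))

x∈p-y-z⁻ : x ∈ p - y - z → x ∈ p × x ≢ y × x ≢ z
x∈p-y-z⁻ {p = p} {y = y} {z = z} x∈ =
  p─q⊆p p ⁅ y ⁆ (p─q⊆p (p - y) ⁅ z ⁆ x∈) , x∈p-y⇒x≢y (p─q⊆p (p - y) ⁅ z ⁆ x∈) , x∈p-y⇒x≢y x∈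

triple : Fin n → Fin n → Fin n → Subset n
triple x y z = ⁅ x ⁆ ∪ ⁅ y ⁆ ∪ ⁅ z ⁆

triple⊆p⁻ : triple x y z ⊆ p → x ∈ p × y ∈ p × z ∈ p
triple⊆p⁻ {x = x} {y = y} {z = z} t⊆p =
  t⊆p (x∈p∪q⁺ (inj₁ (x∈⁅x⁆ x))) ,
  t⊆p (x∈p∪q⁺ (inj₂ (x∈p∪q⁺ (inj₁ (x∈⁅x⁆ y))))) ,
  t⊆p (x∈p∪q⁺ (inj₂ (x∈p∪q⁺ (inj₂ (x∈⁅x⁆ z)))))

w∈triple⁻ : ∀ {w : Fin n} → w ∈ triple x y z → w ≡ x ⊎ w ≡ y ⊎ w ≡ z
w∈triple⁻ {x = x} {y = y} {z = z} w∈ with x∈p∪q⁻ ⁅ x ⁆ _ w∈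
... | inj₁ w∈⁅x⁆ = inj₁ (x∈⁅y⁆⇒x≡y x w∈⁅x⁆)
... | inj₂ w∈⁅y,z⁆ with x∈p∪q⁻ ⁅ y ⁆ ⁅ z ⁆ w∈⁅y,z⁆
...   | inj₁ w∈⁅y⁆ = inj₂ (inj₁ (x∈⁅y⁆⇒x≡y y w∈⁅y⁆))
...   | inj₂ w∈⁅z⁆ = inj₂ (inj₂ (x∈⁅y⁆⇒x≡y z w∈⁅z⁆))

triple⊆p⁺ : x ∈ p → y ∈ p → z ∈ p → triple x y z ⊆ p
triple⊆p⁺ {p = p} x∈p y∈p z∈p w∈ with w∈triple⁻ w∈
... | inj₁ refl        = x∈p
... | inj₂ (inj₁ refl) = y∈p
... | inj₂ (inj₂ refl) = z∈p

∣triple∣≡3 : ∀ {n} {x y z : Fin n} → x ≢ y → x ≢ z → y ≢ z → ∣ triple x y z ∣ ≡ 3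
∣triple∣≡3 {n = n} {x = x} {y = y} {z = z} x≢y x≢z y≢z =
  let (x∈t , y∈t , z∈t) = triple⊆p⁻ ⊆-refl
      z∈t-x-y = x∈p∧x≢y⇒x∈p-y (x∈p∧x≢y⇒x∈p-y z∈t (x≢z ∘ sym)) (y≢z ∘ sym)
  in begin
  ∣ t ∣                  ≡⟨ ∣p∣≡2+∣p-x-y∣ x∈t y∈t x≢y ⟩
  2 + ∣ t - x - y ∣      ≡⟨ cong (2 +_) (x∈p⇒∣p∣≡1+∣p-x∣ z∈t-x-y) ⟩
  3 + ∣ t - x - y - z ∣  ≡⟨ cong (3 +_) (trans (cong ∣_∣ (Empty-unique nothing-left)) (∣⊥∣≡0 n)) ⟩
  3                      ∎
  where
  open ≡-Reasoning
  t = triple x y z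
  nothing-left : ¬ Nonempty (t - x - y - z)
  nothing-left (w , w∈) with x∈p-y-z⁻ {p = t - x} w∈
  ... | w∈t-x , w≢y , w≢z with w∈triple⁻ (p─q⊆p t ⁅ x ⁆ w∈t-x)
  ...   | inj₁ w≡x        = x∈p-y⇒x≢y w∈t-x w≡x
  ...   | inj₂ (inj₁ w≡y) = w≢y w≡y
  ...   | inj₂ (inj₂ w≡z) = w≢z w≡z

disjoint-family⇒∣I∣*s≤∣T∣ :
  (I : Subset m) (F : ∀ {y} → y ∈ I → Subset n) →
  (∀ {y} (y∈I : y ∈ I) → ∣ F y∈I ∣ ≡ s) →
  (∀ {y} (y∈I : y ∈ I) → F y∈I ⊆ T) →
  (∀ {y y′ z} (y∈I : y ∈ I) (y′∈I : y′ ∈ I) → z ∈ F y∈I → z ∈ F y′∈I → y ≡ y′) →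
  ∣ I ∣ * s ≤ ∣ T ∣
disjoint-family⇒∣I∣*s≤∣T∣ [] F size sub disjoint = z≤n
disjoint-family⇒∣I∣*s≤∣T∣ (outside ∷ I) F size sub disjoint =
  disjoint-family⇒∣I∣*s≤∣T∣ I (F ∘ there) (size ∘ there) (sub ∘ there)
    λ y∈I y′∈I x∈ x∈′ → suc-injective (disjoint (there y∈I) (there y′∈I) x∈ x∈′)
disjoint-family⇒∣I∣*s≤∣T∣ {s = s} {T = T} (inside ∷ I) F size sub disjoint = begin
  s + ∣ I ∣ * s          ≤⟨ +-monoʳ-≤ s rest ⟩
  s + ∣ T ─ F₀ ∣         ≡⟨ cong (_+ ∣ T ─ F₀ ∣) (sym (size here)) ⟩
  ∣ F₀ ∣ + ∣ T ─ F₀ ∣    ≡⟨ sym (p⊆q⇒∣q∣≡∣p∣+∣q─p∣ (sub here)) ⟩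
  ∣ T ∣                  ∎
  where
  open ≤-Reasoning
  F₀ = F here
  rest : ∣ I ∣ * s ≤ ∣ T ─ F₀ ∣
  rest = disjoint-family⇒∣I∣*s≤∣T∣ I (F ∘ there) (size ∘ there)
    (λ y∈I x∈ → x∈p∧x∉q⇒x∈p─q (sub (there y∈I) x∈) λ x∈F₀ → 0≢1+n (disjoint here (there y∈I) x∈F₀ x∈))
    λ y∈I y′∈I x∈ x∈′ → suc-injective (disjoint (there y∈I) (there y′∈I) x∈ x∈′)

length≡1⇒singleton : ∀ {A : Set} {xs : List A} → length xs ≡ 1 → ∃ λ a → xs ≡ a ∷ []
length≡1⇒singleton {xs = a ∷ []} _ = a , refl

module SteinerSystem {v k : ℕ} {D : List (Subset v)} (design : IsDesign 3 v k 1 D) where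

  block-size : ∀ {B} → B ∈ₗ D → ∣ B ∣ ≡ k
  block-size = All.lookup (proj₁ (proj₂ design))

  private
    blocks-containing : ∀ {T : Subset v} → ∣ T ∣ ≡ 3 → ∃ λ B → filter (T ⊆?_) D ≡ B ∷ []
    blocks-containing {T} ∣T∣≡3 = length≡1⇒singleton (proj₂ (proj₂ design) T ∣T∣≡3)

  block-through : (T : Subset v) → ∣ T ∣ ≡ 3 → ∃ λ B → B ∈ₗ D × T ⊆ B
  block-through T ∣T∣≡3 with blocks-containing ∣T∣≡3
  ... | B , eq = B , ∈-filter⁻ (T ⊆?_) (subst (B ∈ₗ_) (sym eq) (Any.here refl))

  block-unique : ∀ {T B B′ : Subset v} → ∣ T ∣ ≡ 3 → B ∈ₗ D → B′ ∈ₗ D → T ⊆ B → T ⊆ B′ → B ≡ B′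
  block-unique {T} ∣T∣≡3 B∈D B′∈D T⊆B T⊆B′ with blocks-containing ∣T∣≡3
  ... | B₀ , eq = trans (≡B₀ B∈D T⊆B) (sym (≡B₀ B′∈D T⊆B′))
    where
    ≡B₀ : ∀ {C} → C ∈ₗ D → T ⊆ C → C ≡ B₀
    ≡B₀ C∈D T⊆C with subst (_ ∈ₗ_) eq (∈-filter⁺ (T ⊆?_) C∈D T⊆C)
    ... | Any.here C≡B₀ = C≡B₀

  point-outside : ∀ {B} → k < v → B ∈ₗ D → ∃ λ x → x ∉ B
  point-outside {B} k<v B∈D = ¬∀⟶∃¬ v (_∈ B) (_∈? B) λ all∈B → <⇒≱ k<v (begin
    v          ≡⟨ sym (∣⊤∣≡n v) ⟩
    ∣ ⊤ {v} ∣  ≤⟨ p⊆q⇒∣p∣≤∣q∣ {p = ⊤} {q = B} (λ {x} _ → all∈B x) ⟩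
    ∣ B ∣      ≡⟨ block-size B∈D ⟩
    k          ∎)
    where open ≤-Reasoning

  module _ {B : Subset v} {p x : Fin v} (B∈D : B ∈ₗ D) (p∈B : p ∈ B) (x∉B : x ∉ B) where

    private
      p≢x : p ≢ x
      p≢x refl = x∉B p∈B

      y∈B-p⁻ : y ∈ B - p → y ∈ B × p ≢ y × x ≢ y
      y∈B-p⁻ {y = y} y∈B-p = y∈B , x∈p-y⇒x≢y y∈B-p ∘ sym , λ { refl → x∉B y∈B }
        where y∈B = p─q⊆p B ⁅ p ⁆ y∈B-p

      Line : Fin v → Set
      Line y = ∃ λ C → C ∈ₗ D × p ∈ C × x ∈ C × y ∈ C

      line : y ∈ B - p → Line y
      line {y} y∈B-p =
        let (_ , p≢y , x≢y)   = y∈B-p⁻ y∈B-p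
            (C , C∈D , pxy⊆C) = block-through (triple p x y) (∣triple∣≡3 p≢x p≢y x≢y)
        in C , C∈D , triple⊆p⁻ pxy⊆C

      ∣line-p-x∣ : (ℓ : Line y) → ∣ proj₁ ℓ - p - x ∣ ≡ k ∸ 2
      ∣line-p-x∣ (C , C∈D , p∈C , x∈C , _) =
        cong (_∸ 2) (trans (sym (∣p∣≡2+∣p-x-y∣ p∈C x∈C p≢x)) (block-size C∈D))

      line-p-x⊆⊤-p-x : (ℓ : Line y) → proj₁ ℓ - p - x ⊆ ⊤ - p - x
      line-p-x⊆⊤-p-x _ z∈ =
        let (_ , z≢p , z≢x) = x∈p-y-z⁻ z∈
        in x∈p∧x≢y⇒x∈p-y (x∈p∧x≢y⇒x∈p-y ∈⊤ z≢p) z≢x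

      lines-disjoint : ∀ {y y′ z} → y ∈ B - p → y′ ∈ B - p → (ℓ : Line y) (ℓ′ : Line y′) →
        z ∈ proj₁ ℓ - p - x → z ∈ proj₁ ℓ′ - p - x → y ≡ y′
      lines-disjoint {y} {y′} y∈B-p y′∈B-p (C , C∈D , p∈C , x∈C , y∈C) (C′ , C′∈D , p∈C′ , x∈C′ , y′∈C′) z∈ z∈′ =
        decidable-stable (y ≟ y′) λ y≢y′ → x∉B (subst (x ∈_) (C≡B y≢y′) x∈C)
        where
        C≡C′ : C ≡ C′
        C≡C′ = let (z∈C , z≢p , z≢x) = x∈p-y-z⁻ z∈ in
          block-unique (∣triple∣≡3 p≢x (z≢p ∘ sym) (z≢x ∘ sym)) C∈D C′∈D
            (triple⊆p⁺ p∈C x∈C z∈C) (triple⊆p⁺ p∈C′ x∈C′ (proj₁ (x∈p-y-z⁻ z∈′)))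
        C≡B : y ≢ y′ → C ≡ B
        C≡B y≢y′ =
          let (y∈B , p≢y , _) = y∈B-p⁻ y∈B-p ; (y′∈B , p≢y′ , _) = y∈B-p⁻ y′∈B-p in
          block-unique (∣triple∣≡3 p≢y p≢y′ y≢y′) C∈D B∈D
            (triple⊆p⁺ p∈C y∈C (subst (y′ ∈_) (sym C≡C′) y′∈C′)) (triple⊆p⁺ p∈B y∈B y′∈B)

    [k∸1]*[k∸2]≤v∸2 : (k ∸ 1) * (k ∸ 2) ≤ v ∸ 2
    [k∸1]*[k∸2]≤v∸2 = begin
      (k ∸ 1) * (k ∸ 2)  ≡⟨ cong (λ r → (r ∸ 1) * (k ∸ 2)) (sym (block-size B∈D)) ⟩
      (∣ B ∣ ∸ 1) * (k ∸ 2)  ≡⟨ cong (λ r → (r ∸ 1) * (k ∸ 2)) (x∈p⇒∣p∣≡1+∣p-x∣ p∈B) ⟩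
      ∣ B - p ∣ * (k ∸ 2)  ≤⟨ disjoint-family⇒∣I∣*s≤∣T∣ (B - p) (λ y∈ → proj₁ (line y∈) - p - x)
                               (∣line-p-x∣ ∘ line) (line-p-x⊆⊤-p-x ∘ line)
                               (λ y∈ y′∈ → lines-disjoint y∈ y′∈ (line y∈) (line y′∈)) ⟩
      ∣ ⊤ - p - x ∣      ≡⟨ cong (_∸ 2) (sym (∣p∣≡2+∣p-x-y∣ ∈⊤ ∈⊤ p≢x)) ⟩
      ∣ ⊤ {v} ∣ ∸ 2      ≡⟨ cong (_∸ 2) (∣⊤∣≡n v) ⟩
      v ∸ 2              ∎
      where open ≤-Reasoning

steiner-bound : ∀ {v k} {D : List (Subset v)} → IsDesign 3 v k 1 D → 3 ≤ v → k < v →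
  (k ∸ 1) * (k ∸ 2) ≤ v ∸ 2
steiner-bound {v} design (s≤s (s≤s (s≤s _))) k<v =
  let (B , B∈D , 012⊆B) = block-through (triple 0F 1F 2F) (∣triple∣≡3 {x = 0F} {y = 1F} {z = 2F} (λ ()) (λ ()) (λ ()))
      (x , x∉B)         = point-outside k<v B∈D
  in [k∸1]*[k∸2]≤v∸2 B∈D (proj₁ (triple⊆p⁻ {x = 0F} {y = 1F} {z = 2F} 012⊆B)) x∉B
  where
  open SteinerSystem design
  0F 1F 2F : Fin v
  0F = zero
  1F = suc zero
  2F = suc (suc zero)

2*[1+n]C2≡[1+n]*n : ∀ n → 2 * (suc n C 2) ≡ suc n * n
2*[1+n]C2≡[1+n]*n zero    = refl
2*[1+n]C2≡[1+n]*n (suc n) = begin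
  2 * (suc (suc n) C 2)             ≡⟨ cong (2 *_) (sym (nCk+nC[k+1]≡[n+1]C[k+1] (suc n) 1)) ⟩
  2 * (suc n C 1 + suc n C 2)       ≡⟨ *-distribˡ-+ 2 (suc n C 1) (suc n C 2) ⟩
  2 * (suc n C 1) + 2 * (suc n C 2) ≡⟨ cong₂ (λ a b → 2 * a + b) (nC1≡n (suc n)) (2*[1+n]C2≡[1+n]*n n) ⟩
  2 * suc n + suc n * n             ≡⟨ expand n ⟩
  suc (suc n) * suc n               ∎
  where
  open ≡-Reasoning
  expand : ∀ n → 2 * suc n + suc n * n ≡ suc (suc n) * suc n
  expand = solve-∀

6*[2+n]C3≡[2+n]*[1+n]*n : ∀ n → 6 * (suc (suc n) C 3) ≡ suc (suc n) * suc n * n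
6*[2+n]C3≡[2+n]*[1+n]*n zero    = refl
6*[2+n]C3≡[2+n]*[1+n]*n (suc n) = begin
  6 * (suc (suc (suc n)) C 3)                        ≡⟨ cong (6 *_) (sym (nCk+nC[k+1]≡[n+1]C[k+1] (suc (suc n)) 2)) ⟩
  6 * (suc (suc n) C 2 + suc (suc n) C 3)            ≡⟨ regroup (suc (suc n) C 2) (suc (suc n) C 3) ⟩
  3 * (2 * (suc (suc n) C 2)) + 6 * (suc (suc n) C 3) ≡⟨ cong₂ (λ a b → 3 * a + b) (2*[1+n]C2≡[1+n]*n (suc n)) (6*[2+n]C3≡[2+n]*[1+n]*n n) ⟩
  3 * (suc (suc n) * suc n) + suc (suc n) * suc n * n ≡⟨ expand n ⟩
  suc (suc (suc n)) * suc (suc n) * suc n            ∎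
  where
  open ≡-Reasoning
  regroup : ∀ a b → 6 * (a + b) ≡ 3 * (2 * a) + 6 * b
  regroup = solve-∀
  expand : ∀ n → 3 * (suc (suc n) * suc n) + suc (suc n) * suc n * n ≡ suc (suc (suc n)) * suc (suc n) * suc n
  expand = solve-∀

[1+a]C2∣[1+b]C2 : ∀ {a b} → suc a * a ∣ suc b * b → suc a C 2 ∣ suc b C 2
[1+a]C2∣[1+b]C2 {a} {b} d =
  *-cancelˡ-∣ 2 (subst₂ _∣_ (sym (2*[1+n]C2≡[1+n]*n a)) (sym (2*[1+n]C2≡[1+n]*n b)) d)

[2+a]C3∣[2+b]C3 : ∀ {a b} → suc (suc a) * suc a * a ∣ suc (suc b) * suc b * b → suc (suc a) C 3 ∣ suc (suc b) C 3
[2+a]C3∣[2+b]C3 {a} {b} d =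
  *-cancelˡ-∣ 6 (subst₂ _∣_ (sym (6*[2+n]C3≡[2+n]*[1+n]*n a)) (sym (6*[2+n]C3≡[2+n]*[1+n]*n b)) d)

-- k = 3 + 4m and v = 4 + 10m + 8m² are 4n - 1 and (2n - 1)(4n - 1) + 1 for n = m + 1; the
-- quotients come from v - 1 = (2n - 1) k, v - 2 = 2n (k - 2) and k - 1 = 2 (2n - 1).
admissible : ∀ m → Admissible 3 (4 + 10 * m + 8 * (m * m)) (3 + 4 * m) 1
admissible m zero _ =
  ∣m⇒∣m*n 1 ([2+a]C3∣[2+b]C3 {1 + 4 * m} {2 + 10 * m + 8 * (m * m)}
    (divides ((4 + 10 * m + 8 * (m * m)) * (1 + m)) (factor₃ m)))
  where
  factor₃ : ∀ m → (4 + 10 * m + 8 * (m * m)) * (3 + 10 * m + 8 * (m * m)) * (2 + 10 * m + 8 * (m * m))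
                ≡ (4 + 10 * m + 8 * (m * m)) * (1 + m) * ((3 + 4 * m) * (2 + 4 * m) * (1 + 4 * m))
  factor₃ = solve-∀
admissible m (suc zero) _ =
  ∣m⇒∣m*n 1 ([1+a]C2∣[1+b]C2 {1 + 4 * m} {2 + 10 * m + 8 * (m * m)}
    (divides ((1 + m) * (3 + 4 * m)) (factor₂ m)))
  where
  factor₂ : ∀ m → (3 + 10 * m + 8 * (m * m)) * (2 + 10 * m + 8 * (m * m))
                ≡ (1 + m) * (3 + 4 * m) * ((2 + 4 * m) * (1 + 4 * m))
  factor₂ = solve-∀
admissible m (suc (suc zero)) _ =
  ∣m⇒∣m*n 1 (subst₂ _∣_ (sym (nC1≡n (1 + 4 * m))) (sym (nC1≡n (2 + 10 * m + 8 * (m * m))))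
    (divides (2 * (1 + m)) (factor₁ m)))
  where
  factor₁ : ∀ m → 2 + 10 * m + 8 * (m * m) ≡ 2 * (1 + m) * (1 + 4 * m)
  factor₁ = solve-∀
admissible m (suc (suc (suc zero))) _ = 1∣ _
admissible m (suc (suc (suc (suc _)))) (s≤s (s≤s (s≤s ())))

-- (k - 1)(k - 2) exceeds v - 2 by 2m(4m + 1), which is positive once m ≥ 1.
no-design : ∀ m → 1 ≤ m → ∀ D → ¬ IsDesign 3 (4 + 10 * m + 8 * (m * m)) (3 + 4 * m) 1 D
no-design m@(suc _) _ D design =
  m+1+n≰m (2 + 10 * m + 8 * (m * m))
    (subst (_≤ 2 + 10 * m + 8 * (m * m)) (excess m) (steiner-bound design (s≤s (s≤s (s≤s z≤n))) k<v))
  where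
  excess : ∀ m → (2 + 4 * m) * (1 + 4 * m) ≡ 2 + 10 * m + 8 * (m * m) + 2 * m * (4 * m + 1)
  excess = solve-∀
  v≡k+[1+6m+8m²] : ∀ m → 4 + 10 * m + 8 * (m * m) ≡ 3 + 4 * m + (1 + 6 * m + 8 * (m * m))
  v≡k+[1+6m+8m²] = solve-∀
  k<v : 3 + 4 * m < 4 + 10 * m + 8 * (m * m)
  k<v = subst (3 + 4 * m <_) (sym (v≡k+[1+6m+8m²] m)) (m<m+n (3 + 4 * m) (s≤s z≤n))

theorem3p5 : ∀ (n : ℕ) → 2 ≤ n →
    Admissible 3 ((2 * n ∸ 1) * (4 * n ∸ 1) + 1) (4 * n ∸ 1) 1 ×
    (∀ (D : List (Subset ((2 * n ∸ 1) * (4 * n ∸ 1) + 1))) →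
    ¬ IsDesign 3 ((2 * n ∸ 1) * (4 * n ∸ 1) + 1) (4 * n ∸ 1) 1 D)
theorem3p5 (suc m) (s≤s 1≤m) =
  subst₂ (λ k v → Admissible 3 v k 1 × (∀ D → ¬ IsDesign 3 v k 1 D)) (sym k≡) (sym v≡)
    (admissible m , no-design m 1≤m)
  where
  4[1+m]≡4+4m : ∀ m → 4 * suc m ≡ 4 + 4 * m
  4[1+m]≡4+4m = solve-∀
  2[1+m]≡2+2m : ∀ m → 2 * suc m ≡ 2 + 2 * m
  2[1+m]≡2+2m = solve-∀
  expand : ∀ m → (1 + 2 * m) * (3 + 4 * m) + 1 ≡ 4 + 10 * m + 8 * (m * m)
  expand = solve-∀
  k≡ : 4 * suc m ∸ 1 ≡ 3 + 4 * m
  k≡ = cong (_∸ 1) (4[1+m]≡4+4m m)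
  v≡ : (2 * suc m ∸ 1) * (4 * suc m ∸ 1) + 1 ≡ 4 + 10 * m + 8 * (m * m)
  v≡ = trans (cong₂ (λ a b → a * b + 1) (cong (_∸ 1) (2[1+m]≡2+2m m)) k≡) (expand m)
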